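{- Let $m\geq 2$ and let $\Delta:[1,3m-2]\to\{0,1\}$ be a $2$-coloring. Let $B_1\subseteq[1,3m-2]$ be a monochromatic $m$-subset with $\mathrm{diam}(B_1)\ge 2m-2$ such that (a) $\max B_1$ is minimal among all monochromatic $m$-subsets $B\subseteq[1,3m-2]$ with $\mathrm{diam}(B)\ge 2m-2$; write $\max B_1=3m-2-\beta$ with $\beta\in[0,m-1]$; (b) subject to (a), $\mathrm{diam}(B_1)$ is minimal; write $\mathrm{diam}(B_1)=2m-2+\alpha$ with $\alpha\in[0,m-1-\beta]$. Suppose such $B_1$ exists and $\Delta(B_1)=\{1\}$. Let $R=[1,3m-2-\beta]$. Then one of the following holds. (i) $\beta\le m-2$ and $|\Delta^{ -1}(0)\cap R|\ge m$; there are integers $\mu,\nu\ge 0$ and strings $H_0,H_1$ over $\{0,1\}$ such that $\Delta R=1^{m-1-\beta-\nu}H_0\,0\,H_1\,1^{1+\nu}$; either $\beta=m-1-\alpha$ or $\nu=\mu=0$; $H_1$ has length $m-2-\beta+\mu$ and contains exactly $\mu$ $1$'s and exactly $m-2-\beta$ $0$'s; and $H_0$ has length $m-1+\beta-\mu$ and contains exactly $m-1-\alpha-\mu$ $1$'s and exactly $\alpha+\beta$ $0$'s. (ii) Either $\beta<m-1-\alpha$ or $\beta=m-1$; $\Delta R=0^{m-\alpha-\beta-1}\,1\,H_2\,1^{m-\beta}$ for a string $H_2$ of length $m-2+\beta+\alpha$; if $\beta\le m-2$ then $|\Delta^{ -1}(0)\cap R|\ge m$; and if $\alpha>0$ then $\beta\ge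 1$ and $H_2$ contains exactly $\beta-1$ $1$'s. (iii) $\beta\ge\alpha$; $|\Delta^{ -1}(0)\cap R|<m$; $\mathrm{first}_m(1,R)\le 3m-3-\beta-\alpha$; and $|\Delta^{ -1}(0)\cap[\mathrm{first}_1(1,R),\mathrm{first}_m(1,R)]|\le\beta$.
   Context: $[a,b]$ denotes the set of integers between $a$ and $b$ inclusive. For finite $X\subseteq\mathbb Z$, $\mathrm{diam}(X)=\max X-\min X$. A set is monochromatic if $\Delta$ is constant on it; an $m$-subset has exactly $m$ elements. For a color $c$ and a set $Y$, $\mathrm{first}_i(c,Y)$ denotes the $i$-th smallest element of $Y$ colored $c$. For an interval $I=[a,b]$, $\Delta I$ denotes the string $\Delta(a)\Delta(a+1)\cdots\Delta(b)$, and $x^i$ denotes the string consisting of $i$ copies of the symbol $x$ (juxtaposition is concatenation). -}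

module Defs where

open import Data.Nat using (ℕ; zero; suc; _+_; _*_; _∸_; _≤_; _⊔_; _⊓_)
open import Data.Bool using (Bool; true; false; if_then_else_)
open import Data.Bool.Properties using () renaming (_≟_ to _≟ᵇ_)
open import Data.List using (List; []; _∷_; length; foldr; map; applyUpTo)
open import Data.List.Relation.Unary.All using (All)
open import Data.List.Relation.Unary.Unique.Propositional using (Unique)
open import Data.Maybe using (Maybe; just; nothing)
open import Data.Product using (Σ; ∃; _×_)
open import Relation.Binary.PropositionalEquality using (_≡_)
open import Relation.Nullary using (does)

-- A finite set of integers is represented by a duplicate-free list
-- (all notions used below are invariant under permutation of the list).

maxL : List ℕ → ℕ
maxL = foldr _⊔_ 0

minL : List ℕ → ℕ
minL B = foldr _⊓_ (maxL B) B

diam : List ℕ → ℕ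
diam B = maxL B ∸ minL B

interval : ℕ → ℕ → List ℕ
interval a b = applyUpTo (a +_) (suc b ∸ a)

occ : Bool → List Bool → ℕ
occ x [] = 0
occ x (y ∷ ys) = if does (x ≟ᵇ y) then suc (occ x ys) else occ x ys

word : (ℕ → Bool) → List ℕ → List Bool
word Δ I = map Δ I

positions : (ℕ → Bool) → Bool → List ℕ → List ℕ
positions Δ c [] = []
positions Δ c (x ∷ xs) =
  if does (Δ x ≟ᵇ c) then x ∷ positions Δ c xs else positions Δ c xs

nth : List ℕ → ℕ → Maybe ℕ
nth [] _ = nothing
nth (x ∷ xs) zero = just x
nth (x ∷ xs) (suc i) = nth xs i

-- first_i(c, Y): the i-th smallest element of Y colored c (Y listed increasingly);
-- nothing if it does not exist (or i = 0)
first : (ℕ → Bool) → ℕ → Bool → List ℕ → Maybe ℕ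
first Δ zero c Y = nothing
first Δ (suc i) c Y = nth (positions Δ c Y) i

IsSubsetOfSize : ℕ → ℕ → List ℕ → Set
IsSubsetOfSize N m B = Unique B × length B ≡ m × All (λ x → 1 ≤ x × x ≤ N) B

Monochromatic : (ℕ → Bool) → List ℕ → Set
Monochromatic Δ B = ∃ λ c → All (λ x → Δ x ≡ c) B

Candidate : (ℕ → Bool) → ℕ → List ℕ → Set
Candidate Δ m B =
  IsSubsetOfSize (3 * m ∸ 2) m B × Monochromatic Δ B × 2 * m ∸ 2 ≤ diam B

module Submission where

-- Write m = K + 1, max B₁ = M and min B₁ = δ + 1, so that K = β + α + δ and M = δ + 2K + α + 1,
-- and let ones n and zeros n count the colours in [1, n]. Minimality of max B₁ says that no
-- window [x + 1, y] with y < M, equally coloured ends and diameter at least 2K contains m points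
-- of that colour (it would contain a better candidate); minimality of diam B₁ says the same for
-- the windows [x + 1, M] with δ < x ≤ α + δ. If α = δ = 0 we are in case (ii) with β = m - 1.
-- If R has fewer than m zeros, the first and the last 1 before M are less than 2K apart, which gives
-- case (iii). Otherwise all zeros of R lie within distance 2K of the first zero; if Δ 1 = 0 this
-- pushes them into [1, 2K] and gives case (ii), and if Δ 1 = 1 the (α + β + 1)-th zero splits R
-- into the blocks of case (i).

open import Defs
open import Data.Nat using (ℕ; zero; suc; pred; _+_; _*_; _∸_; _≤_; _<_; _>_; _⊓_; z≤n; s≤s; s≤s⁻¹; z<s; _<?_)
open import Data.Nat.Properties
open import Data.Nat.Tactic.RingSolver using (solve-∀)
open import Data.Bool using (Bool; true; false; not)
open import Data.Bool.Properties using (not-¬; ¬-not) renaming (_≟_ to _≟ᵇ_)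
open import Data.List using (List; []; _∷_; _++_; length; replicate; map; applyUpTo; take; foldr)
open import Data.List.Properties using (map-++; length-map; length-take)
open import Data.List.Relation.Unary.All as All using (All; []; _∷_)
import Data.List.Relation.Unary.All.Properties as All
open import Data.List.Relation.Unary.Any using (here; there)
open import Data.List.Relation.Unary.AllPairs using ([]; _∷_)
open import Data.List.Relation.Unary.Unique.Propositional using (Unique)
import Data.List.Relation.Unary.Unique.Propositional.Properties as Unique
open import Data.List.Membership.Propositional using (_∈_)
open import Data.Maybe using (just)
open import Data.Product using (∃; _×_; _,_; proj₁; proj₂)
open import Data.Sum using (_⊎_; inj₁; inj₂)
open import Data.Empty using (⊥; ⊥-elim)
open import Function using (_∘_)
open import Relation.Nullary using (¬_; yes; no; does)
open import Relation.Binary.PropositionalEquality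

segment : ℕ → ℕ → List ℕ
segment a zero    = []
segment a (suc n) = a ∷ segment (suc a) n

applyUpTo≡segment : ∀ (f : ℕ → ℕ) a n → (∀ i → f i ≡ a + i) → applyUpTo f n ≡ segment a n
applyUpTo≡segment f a zero    f≗a+ = refl
applyUpTo≡segment f a (suc n) f≗a+ = cong₂ _∷_ (trans (f≗a+ 0) (+-identityʳ a))
  (applyUpTo≡segment (f ∘ suc) (suc a) n (λ i → trans (f≗a+ (suc i)) (+-suc a i)))

interval≡segment : ∀ a b → interval a b ≡ segment a (suc b ∸ a)
interval≡segment a b = applyUpTo≡segment (a +_) a _ (λ _ → refl)

segment-++ : ∀ a n k → segment a (n + k) ≡ segment a n ++ segment (a + n) k
segment-++ a zero    k = cong (λ b → segment b k) (sym (+-identityʳ a))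
segment-++ a (suc n) k = cong (a ∷_) (trans (segment-++ (suc a) n k)
  (cong (λ b → segment (suc a) n ++ segment b k) (sym (+-suc a n))))

length-segment : ∀ a n → length (segment a n) ≡ n
length-segment a zero    = refl
length-segment a (suc n) = cong suc (length-segment (suc a) n)

∈-segment⁻ : ∀ {x} a n → x ∈ segment a n → a ≤ x × x < a + n
∈-segment⁻ a (suc n) (here refl) = ≤-refl , m<m+n a z<s
∈-segment⁻ {x} a (suc n) (there p) with ∈-segment⁻ (suc a) n p
... | a<x , x<a+n = <⇒≤ a<x , subst (x <_) (sym (+-suc a n)) x<a+n

∈-segment⁺ : ∀ {x} a n → a ≤ x → x < a + n → x ∈ segment a n
∈-segment⁺ a zero    a≤x x<a+0 = ⊥-elim (<⇒≱ x<a+0 (≤-trans (≤-reflexive (+-identityʳ a)) a≤x))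
∈-segment⁺ {x} a (suc n) a≤x x<a+n with a ≟ x
... | yes refl = here refl
... | no  a≢x  = there (∈-segment⁺ (suc a) n (≤∧≢⇒< a≤x a≢x) (subst (x <_) (+-suc a n) x<a+n))

segment-unique : ∀ a n → Unique (segment a n)
segment-unique a zero    = []
segment-unique a (suc n) =
  All.tabulate (λ p e → <-irrefl e (proj₁ (∈-segment⁻ (suc a) n p))) ∷ segment-unique (suc a) n

occ-++ : ∀ c xs ys → occ c (xs ++ ys) ≡ occ c xs + occ c ys
occ-++ c []       ys = refl
occ-++ c (y ∷ xs) ys with does (c ≟ᵇ y)
... | true  = cong suc (occ-++ c xs ys)
... | false = occ-++ c xs ys

occ-true+occ-false : ∀ xs → occ true xs + occ false xs ≡ length xs
occ-true+occ-false []          = refl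
occ-true+occ-false (true ∷ xs)  = cong suc (occ-true+occ-false xs)
occ-true+occ-false (false ∷ xs) =
  trans (+-suc (occ true xs) (occ false xs)) (cong suc (occ-true+occ-false xs))

occ≤length : ∀ c xs → occ c xs ≤ length xs
occ≤length c []       = z≤n
occ≤length c (y ∷ xs) with does (c ≟ᵇ y)
... | true  = s≤s (occ≤length c xs)
... | false = m≤n⇒m≤1+n (occ≤length c xs)

occ≡length⇒replicate : ∀ c xs → occ c xs ≡ length xs → xs ≡ replicate (length xs) c
occ≡length⇒replicate c []       _ = refl
occ≡length⇒replicate c (y ∷ xs) e with c ≟ᵇ y
... | yes refl = cong (c ∷_) (occ≡length⇒replicate c xs (suc-injective e))
... | no  _    = ⊥-elim (<-irrefl e (s≤s (occ≤length c xs)))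

remove : ∀ {x : ℕ} {ys} → x ∈ ys → List ℕ
remove {ys = y ∷ ys} (here _)  = ys
remove {ys = y ∷ ys} (there p) = y ∷ remove p

length-remove : ∀ {x : ℕ} {ys} (p : x ∈ ys) → suc (length (remove p)) ≡ length ys
length-remove {ys = y ∷ ys} (here _)  = refl
length-remove {ys = y ∷ ys} (there p) = cong suc (length-remove p)

∈-remove : ∀ {x z : ℕ} {ys} (p : x ∈ ys) → z ∈ ys → x ≢ z → z ∈ remove p
∈-remove (here refl) (here refl) x≢z = ⊥-elim (x≢z refl)
∈-remove (here refl) (there q)   x≢z = q
∈-remove (there p)   (here e)    x≢z = here e
∈-remove (there p)   (there q)   x≢z = there (∈-remove p q x≢z)

Unique⇒length≤ : ∀ {xs ys : List ℕ} → Unique xs → All (_∈ ys) xs → length xs ≤ length ys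
Unique⇒length≤ {[]}     _          _         = z≤n
Unique⇒length≤ {x ∷ xs} (x∉xs ∷ u) (p ∷ xs⊆) = ≤-trans
  (s≤s (Unique⇒length≤ u (All.zipWith (λ (q , x≢z) → ∈-remove p q x≢z) (xs⊆ , x∉xs))))
  (≤-reflexive (length-remove p))

≤maxL : ∀ {x} B → x ∈ B → x ≤ maxL B
≤maxL (y ∷ B) (here refl) = m≤m⊔n y (maxL B)
≤maxL (y ∷ B) (there p)   = ≤-trans (≤maxL B p) (m≤n⊔m y (maxL B))

maxL-lub : ∀ {k} B → All (_≤ k) B → maxL B ≤ k
maxL-lub []      []       = z≤n
maxL-lub (y ∷ B) (p ∷ ps) = ⊔-lub p (maxL-lub B ps)

maxL-∈ : ∀ y B → maxL (y ∷ B) ∈ y ∷ B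
maxL-∈ y []      = here (⊔-identityʳ y)
maxL-∈ y (z ∷ B) with ⊔-sel y (maxL (z ∷ B))
... | inj₁ e = here e
... | inj₂ e = subst (_∈ y ∷ z ∷ B) (sym e) (there (maxL-∈ z B))

foldr⊓≤ : ∀ {x} e B → x ∈ B → foldr _⊓_ e B ≤ x
foldr⊓≤ e (y ∷ B) (here refl) = m⊓n≤m y _
foldr⊓≤ e (y ∷ B) (there p)   = ≤-trans (m⊓n≤n y _) (foldr⊓≤ e B p)

foldr⊓-glb : ∀ {k} e B → k ≤ e → All (k ≤_) B → k ≤ foldr _⊓_ e B
foldr⊓-glb e []      k≤e []       = k≤e
foldr⊓-glb e (y ∷ B) k≤e (p ∷ ps) = ⊓-glb p (foldr⊓-glb e B k≤e ps)

foldr⊓-sel : ∀ e B → foldr _⊓_ e B ≡ e ⊎ foldr _⊓_ e B ∈ B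
foldr⊓-sel e []      = inj₁ refl
foldr⊓-sel e (y ∷ B) with ⊓-sel y (foldr _⊓_ e B) | foldr⊓-sel e B
... | inj₁ e₁ | _       = inj₂ (here e₁)
... | inj₂ e₁ | inj₁ e₂ = inj₁ (trans e₁ e₂)
... | inj₂ e₁ | inj₂ p  = inj₂ (subst (_∈ y ∷ B) (sym e₁) (there p))

minL≤ : ∀ {x} B → x ∈ B → minL B ≤ x
minL≤ B = foldr⊓≤ (maxL B) B

minL-glb : ∀ {k} y B → All (k ≤_) (y ∷ B) → k ≤ minL (y ∷ B)
minL-glb y B (p ∷ ps) = foldr⊓-glb _ (y ∷ B) (≤-trans p (≤maxL (y ∷ B) (here refl))) (p ∷ ps)

minL-∈ : ∀ y B → minL (y ∷ B) ∈ y ∷ B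
minL-∈ y B with foldr⊓-sel (maxL (y ∷ B)) (y ∷ B)
... | inj₁ e = subst (_∈ y ∷ B) (sym e) (maxL-∈ y B)
... | inj₂ p = p

wide⇒< : ∀ {m x y} → 2 ≤ m → suc (x + (2 * m ∸ 2)) ≤ y → suc x < y
wide⇒< {m} {x} 2≤m wide = ≤-trans (s≤s (subst (_≤ x + (2 * m ∸ 2)) (+-comm x 1) (+-monoʳ-≤ x 1≤2m∸2))) wide
  where
    1≤2m∸2 : 1 ≤ 2 * m ∸ 2
    1≤2m∸2 = ≤-trans (s≤s z≤n) (∸-monoˡ-≤ 2 (*-monoʳ-≤ 2 2≤m))

candidate-shape : ∀ m {M b} → 1 ≤ m → 1 ≤ b → b ≤ M → M ≤ 3 * m ∸ 2 → 2 * m ∸ 2 ≤ M ∸ b →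
  let β = 3 * m ∸ 2 ∸ M
      α = M ∸ b ∸ (2 * m ∸ 2)
      δ = b ∸ 1
      K = β + α + δ
  in m ≡ suc K × M ≡ suc (δ + (K + K) + α)
candidate-shape (suc k) {M} {b} (s≤s z≤n) 1≤b b≤M M≤N wide = cong suc k≡K , M≡
  where
    β α δ : ℕ
    β = 3 * suc k ∸ 2 ∸ M
    α = M ∸ b ∸ (2 * suc k ∸ 2)
    δ = b ∸ 1
    2m∸2≡2k : 2 * suc k ∸ 2 ≡ k + k
    2m∸2≡2k = cong (_∸ 2) (split k)
      where
        split : ∀ k → 2 * suc k ≡ 2 + (k + k)
        split = solve-∀
    3m∸2≡1+3k : 3 * suc k ∸ 2 ≡ suc (k + (k + k))
    3m∸2≡1+3k = cong (_∸ 2) (split k)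
      where
        split : ∀ k → 3 * suc k ≡ 2 + suc (k + (k + k))
        split = solve-∀
    M≡b+α+2k : M ≡ suc δ + (α + (k + k))
    M≡b+α+2k = begin
      M                                  ≡⟨ m+[n∸m]≡n b≤M ⟨
      b + (M ∸ b)                        ≡⟨ cong (b +_) (m∸n+n≡m wide) ⟨
      b + (α + (2 * suc k ∸ 2))          ≡⟨ cong₂ (λ c w → c + (α + w)) (m+[n∸m]≡n 1≤b) (sym 2m∸2≡2k) ⟨
      suc δ + (α + (k + k))              ∎
      where open ≡-Reasoning
    k≡K : k ≡ β + α + δ
    k≡K = +-cancelʳ-≡ (k + k) k (β + α + δ) (suc-injective (begin
      suc (k + (k + k))                  ≡⟨ 3m∸2≡1+3k ⟨
      3 * suc k ∸ 2                      ≡⟨ m+[n∸m]≡n M≤N ⟨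
      M + β                              ≡⟨ cong (_+ β) M≡b+α+2k ⟩
      suc δ + (α + (k + k)) + β          ≡⟨ rearrange δ α β k ⟩
      suc (β + α + δ + (k + k))          ∎))
      where
        open ≡-Reasoning
        rearrange : ∀ δ α β k → suc δ + (α + (k + k)) + β ≡ suc (β + α + δ + (k + k))
        rearrange = solve-∀
    M≡ : M ≡ suc (δ + ((β + α + δ) + (β + α + δ)) + α)
    M≡ = trans M≡b+α+2k (trans (cong (λ k → suc δ + (α + (k + k))) k≡K) (rearrange δ α (β + α + δ)))
      where
        rearrange : ∀ δ α K → suc δ + (α + (K + K)) ≡ suc (δ + (K + K) + α)
        rearrange = solve-∀

module Counting (Δ : ℕ → Bool) where

  count : Bool → ℕ → ℕ → ℕ
  count c a n = occ c (word Δ (segment a n))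

  prefix : Bool → ℕ → ℕ
  prefix c = count c 1

  length-word-segment : ∀ a n → length (word Δ (segment a n)) ≡ n
  length-word-segment a n = trans (length-map Δ (segment a n)) (length-segment a n)

  word-segment-++ : ∀ a n k →
    word Δ (segment a (n + k)) ≡ word Δ (segment a n) ++ word Δ (segment (a + n) k)
  word-segment-++ a n k = trans (cong (map Δ) (segment-++ a n k)) (map-++ Δ (segment a n) _)

  count-+ : ∀ c a n k → count c a (n + k) ≡ count c a n + count c (a + n) k
  count-+ c a n k = trans (cong (occ c) (word-segment-++ a n k)) (occ-++ c (word Δ (segment a n)) _)

  count+count-not : ∀ c a n → count c a n + count (not c) a n ≡ n
  count+count-not true  a n =
    trans (occ-true+occ-false (word Δ (segment a n))) (length-word-segment a n)
  count+count-not false a n = trans (+-comm (count false a n) _) (count+count-not true a n)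

  count≤ : ∀ c a n → count c a n ≤ n
  count≤ c a n = subst (count c a n ≤_) (length-word-segment a n) (occ≤length c (word Δ (segment a n)))

  count≡⇒replicate : ∀ c a n → count c a n ≡ n → word Δ (segment a n) ≡ replicate n c
  count≡⇒replicate c a n full =
    trans (occ≡length⇒replicate c (word Δ (segment a n)) (trans full (sym (length-word-segment a n))))
          (cong (λ k → replicate k c) (length-word-segment a n))

  prefix-+ : ∀ c n k → prefix c (n + k) ≡ prefix c n + count c (suc n) k
  prefix-+ c = count-+ c 1

  prefix-split : ∀ c {lo hi} → lo ≤ hi → prefix c hi ≡ prefix c lo + count c (suc lo) (hi ∸ lo)
  prefix-split c {lo} lo≤hi = trans (cong (prefix c) (sym (m+[n∸m]≡n lo≤hi))) (prefix-+ c lo _)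

  prefix+prefix-not : ∀ c n → prefix c n + prefix (not c) n ≡ n
  prefix+prefix-not c = count+count-not c 1

  prefix-true+prefix-false : ∀ n → prefix true n + prefix false n ≡ n
  prefix-true+prefix-false = prefix+prefix-not true

  prefix-suc : ∀ c n → prefix c (suc n) ≡ prefix c n + count c (suc n) 1
  prefix-suc c n = trans (cong (prefix c) (+-comm 1 n)) (prefix-+ c n 1)

  count-one-hit : ∀ c a → Δ a ≡ c → count c a 1 ≡ 1
  count-one-hit c a hit with c ≟ᵇ Δ a
  ... | yes _   = refl
  ... | no miss = ⊥-elim (miss (sym hit))

  count-one-miss : ∀ c a → Δ a ≢ c → count c a 1 ≡ 0
  count-one-miss c a miss with c ≟ᵇ Δ a
  ... | yes hit = ⊥-elim (miss (sym hit))
  ... | no _    = refl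

  prefix-hit : ∀ c n → Δ (suc n) ≡ c → prefix c (suc n) ≡ suc (prefix c n)
  prefix-hit c n hit = trans (prefix-suc c n)
    (trans (cong (prefix c n +_) (count-one-hit c (suc n) hit)) (+-comm (prefix c n) 1))

  prefix-miss : ∀ c n → Δ (suc n) ≢ c → prefix c (suc n) ≡ prefix c n
  prefix-miss c n miss = trans (prefix-suc c n)
    (trans (cong (prefix c n +_) (count-one-miss c (suc n) miss)) (+-identityʳ (prefix c n)))

  prefix-suc≤ : ∀ c n → prefix c (suc n) ≤ suc (prefix c n)
  prefix-suc≤ c n with Δ (suc n) ≟ᵇ c
  ... | yes hit = ≤-reflexive (prefix-hit c n hit)
  ... | no miss = ≤-trans (≤-reflexive (prefix-miss c n miss)) (n≤1+n _)

  prefix-mono : ∀ c {n n′} → n ≤ n′ → prefix c n ≤ prefix c n′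
  prefix-mono c {n} n≤n′ =
    subst (prefix c n ≤_) (sym (prefix-split c n≤n′)) (m≤m+n (prefix c n) _)

  prefix-hit-< : ∀ c {x y} → Δ (suc x) ≡ c → x < y → prefix c x < prefix c y
  prefix-hit-< c {x} hit x<y = ≤-trans (≤-reflexive (sym (prefix-hit c x hit))) (prefix-mono c x<y)

  prefix≡0⇒≤ : ∀ c {x d} → Δ (suc x) ≡ c → prefix c d ≡ 0 → d ≤ x
  prefix≡0⇒≤ c hit none = ≮⇒≥ (λ x<d → n≮0 (subst (_ <_) none (prefix-hit-< c hit x<d)))

  -- suc d is the position of the (j + 1)-th occurrence of c
  occurrence : ∀ c n j → j < prefix c n → ∃ λ d → d < n × Δ (suc d) ≡ c × prefix c d ≡ j
  occurrence c (suc n) j j< with j <? prefix c n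
  ... | yes j<′ = let d , d<n , hit , at = occurrence c n j j<′ in d , m≤n⇒m≤1+n d<n , hit , at
  ... | no  j≮ with Δ (suc n) ≟ᵇ c
  ...   | yes hit = n , ≤-refl , hit , ≤-antisym (≮⇒≥ j≮) (s≤s⁻¹ (subst (j <_) (prefix-hit c n hit) j<))
  ...   | no miss = ⊥-elim (j≮ (subst (j <_) (prefix-miss c n miss) j<))

  last-occurrence : ∀ c n → 0 < prefix c n →
    ∃ λ d → d < n × Δ (suc d) ≡ c × prefix c (suc d) ≡ prefix c n
  last-occurrence c n pos with prefix c n in eq
  last-occurrence c n (s≤s _) | suc j with occurrence c n j (≤-reflexive (sym eq))
  ... | d , d<n , hit , at = d , d<n , hit , trans (prefix-hit c d hit) (cong suc at)

  prefix-const⇒colour : ∀ c {a b y} → prefix c a ≡ prefix c b → a < y → y ≤ b → Δ y ≢ c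
  prefix-const⇒colour c {a} {b} {suc y} same (s≤s a≤y) y<b hit = <⇒≱
    (≤-trans (s≤s (prefix-mono c a≤y)) (≤-reflexive (sym (prefix-hit c y hit))))
    (≤-trans (prefix-mono c y<b) (≤-reflexive (sym same)))

  prefix-const⇒count-not : ∀ c a k → prefix c a ≡ prefix c (a + k) → count (not c) (suc a) k ≡ k
  prefix-const⇒count-not c a k same = trans (cong (_+ count (not c) (suc a) k) (sym none))
    (count+count-not c (suc a) k)
    where
      none : count c (suc a) k ≡ 0
      none = +-cancelˡ-≡ (prefix c a) _ 0
        (trans (sym (prefix-+ c a k)) (trans (sym same) (sym (+-identityʳ _))))

  prefix-flat⇒prefix-not : ∀ c a k → prefix c (a + k) ≡ prefix c a →
    prefix (not c) (a + k) ≡ prefix (not c) a + k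
  prefix-flat⇒prefix-not c a k flat =
    trans (prefix-+ (not c) a k) (cong (prefix (not c) a +_) (prefix-const⇒count-not c a k (sym flat)))

  length-positions : ∀ c s → length (positions Δ c s) ≡ occ c (word Δ s)
  length-positions c []      = refl
  length-positions c (x ∷ s) with Δ x ≟ᵇ c | c ≟ᵇ Δ x
  ... | yes _   | yes _   = cong suc (length-positions c s)
  ... | no _    | no _    = length-positions c s
  ... | yes hit | no miss = ⊥-elim (miss (sym hit))
  ... | no miss | yes hit = ⊥-elim (miss (sym hit))

  ∈-positions : ∀ {x} c s → x ∈ s → Δ x ≡ c → x ∈ positions Δ c s
  ∈-positions c (y ∷ s) (here refl) hit with Δ y ≟ᵇ c
  ... | yes _   = here refl
  ... | no miss = ⊥-elim (miss hit)
  ∈-positions c (y ∷ s) (there p) hit with Δ y ≟ᵇ c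
  ... | yes _ = there (∈-positions c s p hit)
  ... | no _  = ∈-positions c s p hit

  positions⁺ : ∀ {P : ℕ → Set} c s → All P s → All P (positions Δ c s)
  positions⁺ c []      []       = []
  positions⁺ c (y ∷ s) (p ∷ ps) with Δ y ≟ᵇ c
  ... | yes _ = p ∷ positions⁺ c s ps
  ... | no _  = positions⁺ c s ps

  positions-coloured : ∀ c s → All (λ x → Δ x ≡ c) (positions Δ c s)
  positions-coloured c []      = []
  positions-coloured c (y ∷ s) with Δ y ≟ᵇ c
  ... | yes hit = hit ∷ positions-coloured c s
  ... | no _    = positions-coloured c s

  positions-unique : ∀ c s → Unique s → Unique (positions Δ c s)
  positions-unique c []      []           = []
  positions-unique c (y ∷ s) (y∉s ∷ uniq) with Δ y ≟ᵇ c
  ... | yes _ = positions⁺ c s y∉s ∷ positions-unique c s uniq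
  ... | no _  = positions-unique c s uniq

  nth-positions-suc : ∀ c a n d → d < n → Δ (a + suc d) ≡ c →
    nth (positions Δ c (segment (suc a) n)) (count c (suc a) d) ≡ just (a + suc d)

  nth-positions : ∀ c a n d → d < n → Δ (a + d) ≡ c →
    nth (positions Δ c (segment a n)) (count c a d) ≡ just (a + d)
  nth-positions c a (suc n) zero _ hit with Δ a ≟ᵇ c
  ... | yes _   = cong just (sym (+-identityʳ a))
  ... | no miss = ⊥-elim (miss (trans (cong Δ (sym (+-identityʳ a))) hit))
  nth-positions c a (suc n) (suc d) (s≤s d<n) hit with Δ a ≟ᵇ c | c ≟ᵇ Δ a
  ... | yes _   | yes _   = nth-positions-suc c a n d d<n hit
  ... | no _    | no _    = nth-positions-suc c a n d d<n hit
  ... | yes hit | no miss = ⊥-elim (miss (sym hit))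
  ... | no miss | yes hit = ⊥-elim (miss (sym hit))

  nth-positions-suc c a n d d<n hit =
    trans (nth-positions c (suc a) n d d<n (trans (cong Δ (sym (+-suc a d))) hit))
          (cong just (sym (+-suc a d)))

  first-at : ∀ c {n d} → d < n → Δ (suc d) ≡ c →
    first Δ (suc (prefix c d)) c (segment 1 n) ≡ just (suc d)
  first-at c {n} {d} = nth-positions c 1 n d

  window-interior : ∀ c x y → suc x < y →
    prefix c y ≤ prefix c x + (2 + count c (suc (suc x)) (y ∸ suc (suc x)))
  window-interior c x (suc y) (s≤s x<y) = begin
    prefix c (suc y)                  ≤⟨ prefix-suc≤ c y ⟩
    suc (prefix c y)                  ≡⟨ cong suc (prefix-split c x<y) ⟩
    suc (prefix c (suc x) + inner)    ≤⟨ s≤s (+-monoˡ-≤ inner (prefix-suc≤ c x)) ⟩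
    suc (suc (prefix c x) + inner)    ≡⟨ trans (+-suc (prefix c x) (suc inner)) (cong suc (+-suc (prefix c x) inner)) ⟨
    prefix c x + (2 + inner)          ∎
    where
      open ≤-Reasoning
      inner : ℕ
      inner = count c (suc (suc x)) (y ∸ suc x)

  window-candidate : ∀ {m} c {x y} → 2 ≤ m → suc (x + (2 * m ∸ 2)) ≤ y → y ≤ 3 * m ∸ 2 →
    Δ (suc x) ≡ c → Δ y ≡ c → prefix c x + m ≤ prefix c y →
    ∃ λ B → Candidate Δ m B × maxL B ≡ y × minL B ≡ suc x
  window-candidate {m} c {x} {y} 2≤m wide y≤N lo-hit y-hit many =
    B , ((unique , length-B , All.map (λ (l , r) → ≤-trans (s≤s z≤n) l , ≤-trans r y≤N) inside)
        , (c , lo-hit ∷ y-hit ∷ All.take⁺ (m ∸ 2) (positions-coloured c I))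
        , subst (2 * m ∸ 2 ≤_) (sym (cong₂ _∸_ max-B min-B))
            (m+n≤o⇒m≤o∸n (2 * m ∸ 2) (subst (_≤ y) (+-comm (suc x) _) wide)))
      , max-B , min-B
    where
      lo : ℕ
      lo = suc x
      lo<y : lo < y
      lo<y = wide⇒< 2≤m wide
      I T B : List ℕ
      I = segment (suc lo) (y ∸ suc lo)
      T = take (m ∸ 2) (positions Δ c I)
      B = lo ∷ y ∷ T
      inside-I : All (λ z → lo < z × z < y) I
      inside-I = All.tabulate λ p → let l , r = ∈-segment⁻ (suc lo) (y ∸ suc lo) p
                                    in l , subst (_ <_) (m+[n∸m]≡n lo<y) r
      inside-T : All (λ z → lo < z × z < y) T
      inside-T = All.take⁺ (m ∸ 2) (positions⁺ c I inside-I)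
      inside : All (λ z → lo ≤ z × z ≤ y) B
      inside = (≤-refl , <⇒≤ lo<y) ∷ (<⇒≤ lo<y , ≤-refl) ∷ All.map (λ (l , r) → <⇒≤ l , <⇒≤ r) inside-T
      unique : Unique B
      unique = ((λ e → <-irrefl e lo<y) ∷ All.map (λ (l , _) e → <-irrefl e l) inside-T)
             ∷ (All.map (λ (_ , r) e → <-irrefl (sym e) r) inside-T ∷ Unique.take⁺ (m ∸ 2)
                 (positions-unique c I (segment-unique (suc lo) (y ∸ suc lo))))
      enough : m ∸ 2 ≤ length (positions Δ c I)
      enough = subst (m ∸ 2 ≤_) (sym (length-positions c I))
        (∸-monoˡ-≤ 2 (+-cancelˡ-≤ (prefix c x) m _ (≤-trans many (window-interior c x y lo<y))))
      length-B : length B ≡ m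
      length-B = trans (cong (λ k → suc (suc k)) (trans (length-take (m ∸ 2) _) (m≤n⇒m⊓n≡m enough)))
                       (m+[n∸m]≡n 2≤m)
      max-B : maxL B ≡ y
      max-B = ≤-antisym (maxL-lub B (All.map proj₂ inside)) (≤maxL B (there (here refl)))
      min-B : minL B ≡ lo
      min-B = ≤-antisym (minL≤ B (here refl)) (minL-glb lo (y ∷ T) (All.map proj₁ inside))

  word-blocks : ∀ c {a} l₀ {p x} l₁ d {k} → l₀ + a ≡ p → count c 1 a ≡ a → Δ (suc p) ≡ x →
    count d (suc (suc p) + l₁) k ≡ k →
    word Δ (segment 1 (a + (l₀ + suc (l₁ + k)))) ≡
      replicate a c ++ word Δ (segment (suc a) l₀) ++ x ∷ word Δ (segment (suc (suc p)) l₁)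
        ++ replicate k d
  word-blocks c {a} l₀ {x = x} l₁ d {k} refl head mid tail = begin
    word Δ (segment 1 (a + (l₀ + suc (l₁ + k))))
      ≡⟨ word-segment-++ 1 a _ ⟩
    word Δ (segment 1 a) ++ word Δ (segment (suc a) (l₀ + suc (l₁ + k)))
      ≡⟨ cong (word Δ (segment 1 a) ++_) (word-segment-++ (suc a) l₀ _) ⟩
    word Δ (segment 1 a) ++ H₀ ++ word Δ (segment (suc (a + l₀)) (suc (l₁ + k)))
      ≡⟨ cong (λ q → word Δ (segment 1 a) ++ H₀ ++ word Δ (segment (suc q) (suc (l₁ + k)))) (+-comm a l₀) ⟩
    word Δ (segment 1 a) ++ H₀ ++ Δ p ∷ word Δ (segment (suc p) (l₁ + k))
      ≡⟨ cong (λ w → word Δ (segment 1 a) ++ H₀ ++ Δ p ∷ w) (word-segment-++ (suc p) l₁ k) ⟩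
    word Δ (segment 1 a) ++ H₀ ++ Δ p ∷ H₁ ++ word Δ (segment (suc p + l₁) k)
      ≡⟨ cong₂ (λ u w → u ++ H₀ ++ w) (count≡⇒replicate c 1 a head)
               (cong₂ (λ y v → y ∷ H₁ ++ v) mid (count≡⇒replicate d (suc p + l₁) k tail)) ⟩
    replicate a c ++ H₀ ++ x ∷ H₁ ++ replicate k d
      ∎
    where
      open ≡-Reasoning
      p : ℕ
      p  = suc (l₀ + a)
      H₀ H₁ : List Bool
      H₀ = word Δ (segment (suc a) l₀)
      H₁ = word Δ (segment (suc p) l₁)

  coloured-subset⇒prefix-gap : ∀ c {B lo hi} → lo ≤ hi → Unique B → All (λ x → Δ x ≡ c) B →
    All (λ x → suc lo ≤ x × x ≤ hi) B → prefix c lo + length B ≤ prefix c hi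
  coloured-subset⇒prefix-gap c {B} {lo} {hi} lo≤hi uniq coloured inside =
    subst (prefix c lo + length B ≤_) (sym (prefix-split c lo≤hi)) (+-monoʳ-≤ (prefix c lo) (begin
      length B                          ≤⟨ Unique⇒length≤ uniq (All.zipWith in-positions (coloured , inside)) ⟩
      length (positions Δ c window)     ≡⟨ length-positions c window ⟩
      count c (suc lo) (hi ∸ lo)        ∎))
    where
      open ≤-Reasoning
      window : List ℕ
      window = segment (suc lo) (hi ∸ lo)
      in-positions : ∀ {x} → Δ x ≡ c × (suc lo ≤ x × x ≤ hi) → x ∈ positions Δ c window
      in-positions (hit , l , r) = ∈-positions c window
        (∈-segment⁺ (suc lo) (hi ∸ lo) l (s≤s (≤-trans r (≤-reflexive (sym (m+[n∸m]≡n lo≤hi)))))) hit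

module _ {Δ : ℕ → Bool} {m : ℕ} {B₁ : List ℕ} (2≤m : 2 ≤ m) (B₁≤N : maxL B₁ ≤ 3 * m ∸ 2) where
  open Counting Δ

  max-minimal⇒window-bound : (∀ B → Candidate Δ m B → maxL B₁ ≤ maxL B) →
    ∀ c x y → Δ (suc x) ≡ c → Δ y ≡ c → y < maxL B₁ → suc (x + (2 * m ∸ 2)) ≤ y →
    prefix c y < prefix c x + m
  max-minimal⇒window-bound max-minimal c x y x-hit y-hit y<M wide = ≰⇒> λ many →
    let B , cand , max-B , _ = window-candidate c 2≤m wide (≤-trans (<⇒≤ y<M) B₁≤N) x-hit y-hit many
    in <-irrefl refl (≤-trans y<M (subst (maxL B₁ ≤_) max-B (max-minimal B cand)))

  diam-minimal⇒start-bound : Δ (maxL B₁) ≡ true →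
    (∀ B → Candidate Δ m B → maxL B ≡ maxL B₁ → diam B₁ ≤ diam B) →
    ∀ x → minL B₁ ≤ x → suc (x + (2 * m ∸ 2)) ≤ maxL B₁ → Δ (suc x) ≡ true →
    prefix true (maxL B₁) < prefix true x + m
  diam-minimal⇒start-bound M-one diam-minimal x b≤x wide x-hit = ≰⇒> λ many →
    let B , cand , max-B , min-B = window-candidate true 2≤m wide B₁≤N x-hit M-one many
    in <⇒≱ (subst (_< diam B₁) (sym (cong₂ _∸_ max-B min-B))
             (∸-monoʳ-< (s≤s b≤x) (<⇒≤ (wide⇒< 2≤m wide))))
           (diam-minimal B cand max-B)

CaseI CaseII CaseIII Conclusion : (m : ℕ) (Δ : ℕ → Bool) (β α : ℕ) (R : List ℕ) → Set
CaseI m Δ β α R =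
  β ≤ m ∸ 2 × m ≤ occ false (word Δ R) ×
    ∃ λ μ → ∃ λ ν → ∃ λ H₀ → ∃ λ H₁ →
      word Δ R ≡ replicate (m ∸ 1 ∸ β ∸ ν) true ++ H₀ ++ false ∷ [] ++ H₁ ++ replicate (1 + ν) true
      × (β ≡ m ∸ 1 ∸ α ⊎ (ν ≡ 0 × μ ≡ 0))
      × length H₁ ≡ m ∸ 2 ∸ β + μ × occ true H₁ ≡ μ × occ false H₁ ≡ m ∸ 2 ∸ β
      × length H₀ ≡ m ∸ 1 + β ∸ μ × occ true H₀ ≡ m ∸ 1 ∸ α ∸ μ × occ false H₀ ≡ α + β
CaseII m Δ β α R =
  (β < m ∸ 1 ∸ α ⊎ β ≡ m ∸ 1) ×
    (∃ λ H₂ →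
      word Δ R ≡ replicate (m ∸ α ∸ β ∸ 1) false ++ true ∷ [] ++ H₂ ++ replicate (m ∸ β) true
      × length H₂ ≡ m ∸ 2 + β + α
      × (α > 0 → 1 ≤ β × occ true H₂ ≡ β ∸ 1))
    × (β ≤ m ∸ 2 → m ≤ occ false (word Δ R))
CaseIII m Δ β α R =
  α ≤ β × occ false (word Δ R) < m ×
    ∃ λ f₁ → ∃ λ fₘ →
      first Δ 1 true R ≡ just f₁ × first Δ m true R ≡ just fₘ
      × fₘ ≤ 3 * m ∸ 3 ∸ β ∸ α
      × occ false (word Δ (interval f₁ fₘ)) ≤ β
Conclusion m Δ β α R = CaseI m Δ β α R ⊎ CaseII m Δ β α R ⊎ CaseIII m Δ β α R

-- M = max B₁ and suc δ = min B₁, the values of β and α being those of the statement.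
module Analysis (Δ : ℕ → Bool) (β α δ : ℕ) where
  open Counting Δ

  K m M′ M : ℕ
  K  = β + α + δ
  m  = suc K
  M′ = δ + (K + K) + α
  M  = suc M′

  ones zeros : ℕ → ℕ
  ones  = prefix true
  zeros = prefix false

  ones+zeros : ∀ n → ones n + zeros n ≡ n
  ones+zeros = prefix-true+prefix-false

  m∸α∸β∸1≡δ : m ∸ α ∸ β ∸ 1 ≡ δ
  m∸α∸β∸1≡δ = begin
    m ∸ α ∸ β ∸ 1                   ≡⟨ cong (λ n → n ∸ α ∸ β ∸ 1) (split β α δ) ⟩
    α + (β + (1 + δ)) ∸ α ∸ β ∸ 1   ≡⟨ cong (λ n → n ∸ β ∸ 1) (m+n∸m≡n α _) ⟩
    β + (1 + δ) ∸ β ∸ 1             ≡⟨ cong (_∸ 1) (m+n∸m≡n β _) ⟩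
    δ                               ∎
    where
      open ≡-Reasoning
      split : ∀ β α δ → suc (β + α + δ) ≡ α + (β + (1 + δ))
      split = solve-∀

  m≡β+suc-α+δ : m ≡ β + suc (α + δ)
  m≡β+suc-α+δ = split β α δ
    where
      split : ∀ β α δ → suc (β + α + δ) ≡ β + suc (α + δ)
      split = solve-∀

  m∸β≡1+α+δ : m ∸ β ≡ suc (α + δ)
  m∸β≡1+α+δ = trans (cong (_∸ β) m≡β+suc-α+δ) (m+n∸m≡n β _)

  K∸α≡β+δ : K ∸ α ≡ β + δ
  K∸α≡β+δ = trans (cong (_∸ α) (split β α δ)) (m+n∸m≡n α _)
    where
      split : ∀ β α δ → β + α + δ ≡ α + (β + δ)
      split = solve-∀

  K∸β≡α+δ : K ∸ β ≡ α + δ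
  K∸β≡α+δ = trans (cong (_∸ β) (+-assoc β α δ)) (m+n∸m≡n β _)

  3m∸3∸β∸α≡δ+2K : 3 * m ∸ 3 ∸ β ∸ α ≡ δ + (K + K)
  3m∸3∸β∸α≡δ+2K = begin
    3 * m ∸ 3 ∸ β ∸ α                      ≡⟨ cong (λ n → n ∸ 3 ∸ β ∸ α) (split β α δ) ⟩
    3 + (β + (α + (δ + (K + K)))) ∸ 3 ∸ β ∸ α ≡⟨ cong (λ n → n ∸ β ∸ α) (m+n∸m≡n 3 _) ⟩
    β + (α + (δ + (K + K))) ∸ β ∸ α        ≡⟨ cong (_∸ α) (m+n∸m≡n β _) ⟩
    α + (δ + (K + K)) ∸ α                  ≡⟨ m+n∸m≡n α _ ⟩
    δ + (K + K)                            ∎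
    where
      open ≡-Reasoning
      split : ∀ β α δ → let K = β + α + δ in 3 * suc K ≡ 3 + (β + (α + (δ + (K + K))))
      split = solve-∀

  3m∸2∸β≡M : 3 * m ∸ 2 ∸ β ≡ M
  3m∸2∸β≡M = trans (cong (λ n → n ∸ 2 ∸ β) (split β α δ)) (trans (cong (_∸ β) (m+n∸m≡n 2 _)) (m+n∸m≡n β _))
    where
      split : ∀ β α δ → let K = β + α + δ in 3 * suc K ≡ 2 + (β + suc (δ + (K + K) + α))
      split = solve-∀

  M′≡α+δ+2K : M′ ≡ (α + δ) + (K + K)
  M′≡α+δ+2K = split δ α K
    where
      split : ∀ δ α K → δ + (K + K) + α ≡ (α + δ) + (K + K)
      split = solve-∀

  -- window-bound is the minimality (a) of max B₁, start-bound the minimality (b) of diam B₁.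
  module _ (K≥1 : 1 ≤ K) (first-one : Δ (suc δ) ≡ true) (last-one : Δ M ≡ true)
           (enough-ones : ones δ + m ≤ ones M)
           (window-bound : ∀ c x y → Δ (suc x) ≡ c → Δ y ≡ c → y < M → suc (x + (K + K)) ≤ y →
                           prefix c y < prefix c x + m)
           (start-bound : ∀ x → suc δ ≤ x → x ≤ α + δ → Δ (suc x) ≡ true → ones M < ones x + m)
           where

    zeros-M : zeros M ≡ zeros M′
    zeros-M = prefix-miss false M′ (not-¬ last-one)

    ones-M : ones M ≡ suc (ones M′)
    ones-M = prefix-hit true M′ last-one

    ones-suc-δ : ones (suc δ) ≡ suc (ones δ)
    ones-suc-δ = prefix-hit true δ first-one

    ones-δ+K≤ones-M′ : ones δ + K ≤ ones M′
    ones-δ+K≤ones-M′ = s≤s⁻¹ (subst₂ _≤_ (+-suc (ones δ) K) ones-M enough-ones)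

    last-zero : 0 < zeros M → ∃ λ d → suc d < M × Δ (suc d) ≡ false × zeros (suc d) ≡ zeros M
    last-zero pos with last-occurrence false M pos
    ... | d , d<M , hit , same =
      d , ≤∧≢⇒< d<M (λ d≡M → not-¬ last-one (subst (λ y → Δ y ≡ false) d≡M hit)) , hit , same

    ones-flat : ones (suc δ) + m ≤ ones M → ∀ i → i ≤ α → ones (suc δ + i) ≡ ones (suc δ)
    ones-flat surplus zero    _   = cong ones (+-identityʳ (suc δ))
    ones-flat surplus (suc i) i<α with Δ (suc (suc δ + i)) ≟ᵇ true
    ... | yes hit = ⊥-elim (<⇒≱
      (start-bound (suc δ + i) (m≤m+n (suc δ) i) (≤-trans (≤-reflexive (cong suc (+-comm δ i))) (+-monoˡ-≤ δ i<α)) hit)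
      (subst (λ n → n + m ≤ ones M) (sym (ones-flat surplus i (<⇒≤ i<α))) surplus))
    ... | no miss = trans (cong ones (+-suc (suc δ) i))
                          (trans (prefix-miss true (suc δ + i) miss) (ones-flat surplus i (<⇒≤ i<α)))

    l₂ : ℕ
    l₂ = K ∸ 1 + β + α

    H₂ : List Bool
    H₂ = word Δ (segment (suc (suc δ)) l₂)

    2K≡δ+suc-l₂ : K + K ≡ δ + suc l₂
    2K≡δ+suc-l₂ = sym (trans (cong (λ k → δ + (k + β + α)) (m+[n∸m]≡n K≥1)) (rearrange β α δ))
      where
        rearrange : ∀ β α δ → δ + ((β + α + δ) + β + α) ≡ (β + α + δ) + (β + α + δ)
        rearrange = solve-∀

    M≡2K+suc-α+δ : M ≡ K + K + suc (α + δ)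
    M≡2K+suc-α+δ = rearrange δ α K
      where
        rearrange : ∀ δ α K → suc (δ + (K + K) + α) ≡ K + K + suc (α + δ)
        rearrange = solve-∀

    case-ii-word : zeros δ ≡ δ → count true (suc (K + K)) (suc (α + δ)) ≡ suc (α + δ) →
      word Δ (segment 1 M) ≡ replicate (m ∸ α ∸ β ∸ 1) false ++ true ∷ [] ++ H₂ ++ replicate (m ∸ β) true
    case-ii-word zeros-δ tail = begin
      word Δ (segment 1 M)
        ≡⟨ cong (word Δ ∘ segment 1) M≡blocks ⟩
      word Δ (segment 1 (δ + (0 + suc (l₂ + suc (α + δ)))))
        ≡⟨ word-blocks false 0 l₂ true refl zeros-δ first-one
             (subst (λ p → count true (suc p) (suc (α + δ)) ≡ suc (α + δ)) 2K≡suc-δ+l₂ tail) ⟩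
      replicate δ false ++ true ∷ H₂ ++ replicate (suc (α + δ)) true
        ≡⟨ cong₂ (λ i j → replicate i false ++ true ∷ H₂ ++ replicate j true) m∸α∸β∸1≡δ m∸β≡1+α+δ ⟨
      replicate (m ∸ α ∸ β ∸ 1) false ++ true ∷ H₂ ++ replicate (m ∸ β) true
        ∎
      where
        open ≡-Reasoning
        2K≡suc-δ+l₂ : K + K ≡ suc (δ + l₂)
        2K≡suc-δ+l₂ = trans 2K≡δ+suc-l₂ (+-suc δ l₂)
        M≡blocks : M ≡ δ + suc (l₂ + suc (α + δ))
        M≡blocks = trans M≡2K+suc-α+δ (trans (cong (_+ suc (α + δ)) 2K≡δ+suc-l₂) (+-assoc δ (suc l₂) _))

    case-ii-degenerate : α ≡ 0 → δ ≡ 0 → CaseII m Δ β α (segment 1 M)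
    case-ii-degenerate α≡0 δ≡0 =
      inj₂ (sym K≡β) ,
      (H₂ , case-ii-word zeros-δ tail , length-word-segment _ l₂ , λ α>0 → ⊥-elim (<-irrefl (sym α≡0) α>0)) ,
      λ β≤K∸1 → ⊥-elim (<-irrefl (sym K≡β) (≤-trans (s≤s β≤K∸1) (≤-reflexive (m+[n∸m]≡n K≥1))))
      where
        K≡β : K ≡ β
        K≡β = trans (cong₂ (λ a d → β + a + d) α≡0 δ≡0) (trans (+-identityʳ (β + 0)) (+-identityʳ β))
        M≡suc-2K : suc (K + K) ≡ M
        M≡suc-2K = trans (cong suc (sym (+-identityʳ (K + K)))) (sym (cong₂ (λ a d → suc (d + (K + K) + a)) α≡0 δ≡0))
        zeros-δ : zeros δ ≡ δ
        zeros-δ = subst (λ d → zeros d ≡ d) (sym δ≡0) refl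
        tail : count true (suc (K + K)) (suc (α + δ)) ≡ suc (α + δ)
        tail = subst (λ n → count true (suc (K + K)) (suc n) ≡ suc n) (sym (cong₂ _+_ α≡0 δ≡0))
                 (count-one-hit true (suc (K + K)) (subst (λ y → Δ y ≡ true) (sym M≡suc-2K) last-one))

    ones-H₂ : ones δ ≡ 0 → Δ M′ ≡ true → count true (suc (K + K)) (suc (α + δ)) ≡ suc (α + δ) →
      α > 0 → 1 ≤ β × occ true H₂ ≡ β ∸ 1
    ones-H₂ no-ones-before-δ last-but-one tail α>0 = subst (1 ≤_) suc-h≡β z<s , cong pred suc-h≡β
      where
        open ≡-Reasoning
        h : ℕ
        h = occ true H₂
        ones-M′≡K : ones M′ ≡ K
        ones-M′≡K = ≤-antisym
          (s≤s⁻¹ (subst (λ o → ones M′ < o + m) no-ones-before-δ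
            (window-bound true δ M′ first-one last-but-one ≤-refl
              (≤-trans (≤-reflexive (+-comm 1 (δ + (K + K)))) (+-monoʳ-≤ _ α>0)))))
          (subst (λ o → o + K ≤ ones M′) no-ones-before-δ ones-δ+K≤ones-M′)
        ones-2K : ones (K + K) ≡ suc h
        ones-2K = begin
          ones (K + K)                  ≡⟨ cong ones (trans 2K≡δ+suc-l₂ (+-suc δ l₂)) ⟩
          ones (suc δ + l₂)             ≡⟨ prefix-+ true (suc δ) l₂ ⟩
          ones (suc δ) + h              ≡⟨ cong (_+ h) (trans ones-suc-δ (cong suc no-ones-before-δ)) ⟩
          suc h                         ∎
        suc-h≡β : suc h ≡ β
        suc-h≡β = +-cancelʳ-≡ (suc (α + δ)) (suc h) β (begin
          suc h + suc (α + δ)                                   ≡⟨ cong₂ _+_ ones-2K tail ⟨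
          ones (K + K) + count true (suc (K + K)) (suc (α + δ)) ≡⟨ prefix-+ true (K + K) _ ⟨
          ones (K + K + suc (α + δ))                            ≡⟨ cong ones M≡2K+suc-α+δ ⟨
          ones M                                                ≡⟨ trans ones-M (cong suc ones-M′≡K) ⟩
          suc K                                                 ≡⟨ m≡β+suc-α+δ ⟩
          β + suc (α + δ)                                       ∎)

    case-ii : 1 ≤ α + δ → m ≤ zeros M → Δ 1 ≡ false → CaseII m Δ β α (segment 1 M)
    case-ii α+δ≥1 many-zeros starts-zero with last-zero (≤-trans z<s many-zeros)
    ... | dq , dq<M , dq-zero , zeros-dq =
      inj₁ (subst (β <_) (sym K∸α≡β+δ) (m<m+n β δ≥1)) ,
      (H₂ , case-ii-word zeros-δ tail , length-word-segment _ l₂ , ones-H₂ no-ones-before-δ last-but-one tail) ,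
      λ _ → many-zeros
      where
        dq<2K : suc dq ≤ K + K
        dq<2K = ≮⇒≥ λ 2K<dq → <⇒≱ (window-bound false 0 (suc dq) starts-zero dq-zero dq<M 2K<dq)
                                  (subst (m ≤_) (sym zeros-dq) many-zeros)
        zeros-2K : zeros (K + K) ≡ zeros M
        zeros-2K = ≤-antisym (prefix-mono false (≤-trans (m≤n+m _ δ) (≤-trans (m≤m+n _ α) (n≤1+n M′))))
                             (≤-trans (≤-reflexive (sym zeros-dq)) (prefix-mono false dq<2K))
        δ≥1 : 1 ≤ δ
        δ≥1 = n≢0⇒n>0 λ δ≡0 → not-¬ first-one (subst (λ d → Δ (suc d) ≡ false) (sym δ≡0) starts-zero)
        2K<M′ : K + K < M′
        2K<M′ = ≤-trans (≤-trans (≤-reflexive (+-comm 1 (K + K))) (+-monoʳ-≤ (K + K) δ≥1))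
                        (≤-trans (≤-reflexive (+-comm (K + K) δ)) (m≤m+n _ α))
        last-but-one : Δ M′ ≡ true
        last-but-one = ¬-not (prefix-const⇒colour false zeros-2K 2K<M′ (n≤1+n M′))
        no-ones-before-δ : ones δ ≡ 0
        no-ones-before-δ = n≤0⇒n≡0 (≮⇒≥ λ pos →
          let d , d<δ , d-one , ones-d = occurrence true δ 0 pos
          in <⇒≱ (window-bound true d M′ d-one last-but-one ≤-refl
                   (≤-trans (+-monoˡ-≤ (K + K) d<δ) (m≤m+n _ α)))
                 (≤-trans (subst (λ o → o + m ≤ ones δ + K) (sym ones-d) (+-monoˡ-≤ K pos)) ones-δ+K≤ones-M′))
        zeros-δ : zeros δ ≡ δ
        zeros-δ = trans (cong (_+ zeros δ) (sym no-ones-before-δ)) (ones+zeros δ)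
        tail : count true (suc (K + K)) (suc (α + δ)) ≡ suc (α + δ)
        tail = prefix-const⇒count-not false (K + K) (suc (α + δ)) (trans zeros-2K (cong zeros M≡2K+suc-α+δ))

    α≤β : ∀ {d₁ de} → d₁ ≤ δ → zeros d₁ ≡ d₁ → ones (suc de) ≡ ones M′ → zeros (suc de) ≤ d₁ + β →
          M′ ≤ ones M′ + K → α ≤ β
    α≤β {d₁} {de} d₁≤δ zeros-d₁ ones-de zeros-de M′≤ with m≤n⇒m<n∨m≡n enough-ones
    ... | inj₂ tight = ≤-trans (+-cancelˡ-≤ (δ + (K + K)) α 0 (begin
      δ + (K + K) + α          ≤⟨ M′≤ ⟩
      ones M′ + K              ≡⟨ cong (_+ K) (suc-injective (trans (sym (+-suc (ones δ) K)) (trans tight ones-M))) ⟨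
      ones δ + K + K           ≤⟨ +-monoˡ-≤ K (+-monoˡ-≤ K (count≤ true 1 δ)) ⟩
      δ + K + K                ≡⟨ trans (+-assoc δ K K) (sym (+-identityʳ _)) ⟩
      δ + (K + K) + 0          ∎)) z≤n
      where open ≤-Reasoning
    ... | inj₁ loose = +-cancelˡ-≤ d₁ α β (begin
      d₁ + α                   ≤⟨ +-monoˡ-≤ α (subst (_≤ zeros (suc δ)) zeros-d₁ (prefix-mono false (m≤n⇒m≤1+n d₁≤δ))) ⟩
      zeros (suc δ) + α        ≡⟨ prefix-flat⇒prefix-not true (suc δ) α flat ⟨
      zeros (suc δ + α)        ≤⟨ prefix-mono false start≤de ⟩
      zeros (suc de)           ≤⟨ zeros-de ⟩
      d₁ + β                   ∎)
      where
        open ≤-Reasoning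
        surplus : ones (suc δ) + m ≤ ones M
        surplus = subst (λ o → o + m ≤ ones M) (sym ones-suc-δ) loose
        flat : ones (suc δ + α) ≡ ones (suc δ)
        flat = ones-flat surplus α ≤-refl
        start≤de : suc δ + α ≤ suc de
        start≤de = ≮⇒≥ λ de<start → <⇒≱ (s≤s⁻¹ (subst₂ _<_ (+-suc (ones δ) K) ones-M loose))
          (begin
            ones M′                  ≡⟨ ones-de ⟨
            ones (suc de)            ≤⟨ prefix-mono true (<⇒≤ de<start) ⟩
            ones (suc δ + α)         ≡⟨ trans flat ones-suc-δ ⟩
            suc (ones δ)             ≡⟨ +-comm 1 (ones δ) ⟩
            ones δ + 1               ≤⟨ +-monoʳ-≤ (ones δ) K≥1 ⟩
            ones δ + K               ∎)

    M′≤ones+K : zeros M < m → M′ ≤ ones M′ + K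
    M′≤ones+K few-zeros = subst (_≤ ones M′ + K) (ones+zeros M′)
      (+-monoʳ-≤ (ones M′) (s≤s⁻¹ (subst (_< m) zeros-M few-zeros)))

    few-zeros⇒K<ones-M′ : 1 ≤ α + δ → zeros M < m → K < ones M′
    few-zeros⇒K<ones-M′ α+δ≥1 few-zeros = +-cancelʳ-≤ K (suc K) (ones M′) (begin
      suc K + K            ≤⟨ +-monoˡ-≤ (K + K) α+δ≥1 ⟩
      α + δ + (K + K)      ≡⟨ M′≡α+δ+2K ⟨
      M′                   ≤⟨ M′≤ones+K few-zeros ⟩
      ones M′ + K          ∎)
      where open ≤-Reasoning

    zeros-to-last-one : zeros M < m → ∀ {d₁ de} → ones (suc de) ≡ ones M′ → suc de ≤ d₁ + (K + K) →
      zeros (suc de) ≤ d₁ + β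
    zeros-to-last-one few-zeros {d₁} {de} ones-de de<d₁+2K = +-cancelʳ-≤ M′ (zeros (suc de)) (d₁ + β) (begin
      zeros (suc de) + M′                  ≤⟨ +-monoʳ-≤ (zeros (suc de)) (M′≤ones+K few-zeros) ⟩
      zeros (suc de) + (ones M′ + K)       ≡⟨ cong (λ o → zeros (suc de) + (o + K)) ones-de ⟨
      zeros (suc de) + (ones (suc de) + K) ≡⟨ +-assoc (zeros (suc de)) _ K ⟨
      zeros (suc de) + ones (suc de) + K   ≡⟨ cong (_+ K) (trans (+-comm _ (ones (suc de))) (ones+zeros (suc de))) ⟩
      suc de + K                           ≤⟨ +-monoˡ-≤ K de<d₁+2K ⟩
      d₁ + (K + K) + K                     ≡⟨ rearrange d₁ β α δ ⟩
      d₁ + β + M′                          ∎)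
      where
        open ≤-Reasoning
        rearrange : ∀ d β α δ → let K = β + α + δ in d + (K + K) + K ≡ d + β + (δ + (K + K) + α)
        rearrange = solve-∀

    case-iii : 1 ≤ α + δ → zeros M < m → CaseIII m Δ β α (segment 1 M)
    case-iii α+δ≥1 few-zeros
      with occurrence true M′ 0 (≤-trans z<s (few-zeros⇒K<ones-M′ α+δ≥1 few-zeros))
         | occurrence true M′ K (few-zeros⇒K<ones-M′ α+δ≥1 few-zeros)
         | last-occurrence true M′ (≤-trans z<s (few-zeros⇒K<ones-M′ α+δ≥1 few-zeros))
    ... | d₁ , d₁<M′ , d₁-one , ones-d₁ | dm , dm<M′ , dm-one , ones-dm | de , de<M′ , de-one , ones-de =
      α≤β {d₁} {de} d₁≤δ zeros-d₁ ones-de zeros-de (M′≤ones+K few-zeros) , few-zeros , suc d₁ , suc dm ,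
      subst (λ i → first Δ (suc i) true (segment 1 M) ≡ just (suc d₁)) ones-d₁
        (first-at true (m≤n⇒m≤1+n d₁<M′) d₁-one) ,
      subst (λ i → first Δ (suc i) true (segment 1 M) ≡ just (suc dm)) ones-dm
        (first-at true (m≤n⇒m≤1+n dm<M′) dm-one) ,
      subst (suc dm ≤_) (sym 3m∸3∸β∸α≡δ+2K)
        (≤-trans (s≤s dm≤de) (≤-trans de<d₁+2K (+-monoˡ-≤ (K + K) d₁≤δ))) ,
      subst (λ s → occ false (word Δ s) ≤ β) (sym (interval≡segment (suc d₁) (suc dm)))
      (+-cancelˡ-≤ d₁ _ β (begin
        d₁ + count false (suc d₁) (suc dm ∸ d₁)       ≡⟨ cong (_+ count false (suc d₁) (suc dm ∸ d₁)) zeros-d₁ ⟨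
        zeros d₁ + count false (suc d₁) (suc dm ∸ d₁) ≡⟨ prefix-split false (≤-trans d₁≤dm (n≤1+n dm)) ⟨
        zeros (suc dm)                                ≤⟨ prefix-mono false (s≤s dm≤de) ⟩
        zeros (suc de)                                ≤⟨ zeros-de ⟩
        d₁ + β                                        ∎))
      where
        open ≤-Reasoning
        K<ones : K < ones M′
        K<ones = few-zeros⇒K<ones-M′ α+δ≥1 few-zeros
        d₁≤δ : d₁ ≤ δ
        d₁≤δ = prefix≡0⇒≤ true first-one ones-d₁
        d₁≤dm : d₁ ≤ dm
        d₁≤dm = prefix≡0⇒≤ true dm-one ones-d₁
        zeros-d₁ : zeros d₁ ≡ d₁
        zeros-d₁ = trans (cong (_+ zeros d₁) (sym ones-d₁)) (ones+zeros d₁)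
        de<d₁+2K : suc de ≤ d₁ + (K + K)
        de<d₁+2K = ≮⇒≥ λ far → <⇒≱ K<ones (s≤s⁻¹ (subst₂ (λ a b → a < b + m) ones-de ones-d₁
                     (window-bound true d₁ (suc de) d₁-one de-one (s≤s de<M′) far)))
        dm≤de : dm ≤ de
        dm≤de = ≮⇒≥ λ de<dm → <⇒≱ K<ones (subst₂ _≤_ ones-de ones-dm (prefix-mono true de<dm))
        zeros-de : zeros (suc de) ≤ d₁ + β
        zeros-de = zeros-to-last-one few-zeros ones-de de<d₁+2K

    -- suc dp and suc dq are the first and the last zero of R.
    module CaseI-setup (α+δ≥1 : 1 ≤ α + δ) (many-zeros : m ≤ zeros M) (starts-one : Δ 1 ≡ true)
                       (dp : ℕ) (dp-zero : Δ (suc dp) ≡ false) (zeros-dp : zeros dp ≡ 0)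
                       (dq : ℕ) (dq<M : suc dq < M) (dq-zero : Δ (suc dq) ≡ false)
                       (zeros-dq : zeros (suc dq) ≡ zeros M) where

      zeros-span : suc dq ≤ dp + (K + K)
      zeros-span = ≮⇒≥ λ far → <⇒≱ (window-bound false dp (suc dq) dp-zero dq-zero dq<M far)
        (subst₂ (λ z z′ → z′ + m ≤ z) (sym zeros-dq) (sym zeros-dp) many-zeros)

      ones-from-start : ∀ {y} → Δ y ≡ true → y < M → suc (K + K) ≤ y → ones y ≤ K
      ones-from-start {y} y-one y<M far = s≤s⁻¹ (window-bound true 0 y starts-one y-one y<M far)

      2K<M′ : suc (K + K) ≤ M′
      2K<M′ = ≤-trans (≤-reflexive (+-comm 1 (K + K)))
                      (≤-trans (+-monoʳ-≤ (K + K) α+δ≥1) (≤-reflexive (trans (+-comm (K + K) _) (sym M′≡α+δ+2K))))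

      δ+K≮ones-δ+K≤ones-M′ : ¬ (δ + K < ones M′)
      δ+K≮ones-δ+K≤ones-M′ big = <⇒≱ (≤-trans (m≤n+m (suc K) δ) (≤-trans (≤-reflexive (+-suc δ K)) big))
                         (ones-from-start last-but-one ≤-refl 2K<M′)
        where
          α≥2 : 2 ≤ α
          α≥2 = +-cancelˡ-≤ (δ + (K + K)) 2 α (s≤s⁻¹ (begin
            suc (δ + (K + K) + 2)          ≡⟨ rearrange δ K ⟩
            suc (suc (δ + K)) + suc K      ≤⟨ +-mono-≤ (s≤s big) many-zeros ⟩
            suc (ones M′) + zeros M        ≡⟨ cong (_+ zeros M) ones-M ⟨
            ones M + zeros M               ≡⟨ ones+zeros M ⟩
            M                              ∎))
            where
              open ≤-Reasoning
              rearrange : ∀ δ K → suc (δ + (K + K) + 2) ≡ suc (suc (δ + K)) + suc K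
              rearrange = solve-∀
          surplus : ones (suc δ) + m ≤ ones M
          surplus = ≤-trans (+-monoˡ-≤ m (count≤ true 1 (suc δ)))
                            (subst (suc δ + m ≤_) (sym ones-M) (s≤s (subst (_≤ ones M′) (sym (+-suc δ K)) big)))
          second-zero : Δ (suc (suc δ)) ≡ false
          second-zero = ¬-not (prefix-const⇒colour true (sym (ones-flat surplus 1 (≤-trans (s≤s z≤n) α≥2)))
                                 ≤-refl (s≤s (≤-reflexive (+-comm 1 δ))))
          zeros-after : zeros (suc δ + (K + K)) ≡ zeros M
          zeros-after = ≤-antisym
            (prefix-mono false (s≤s (m≤m+n (δ + (K + K)) α)))
            (≤-trans (≤-reflexive (sym zeros-dq))
              (prefix-mono false (≤-trans zeros-span (+-monoˡ-≤ (K + K) (prefix≡0⇒≤ false {d = dp} second-zero zeros-dp)))))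
          last-but-one : Δ M′ ≡ true
          last-but-one = ¬-not (prefix-const⇒colour false zeros-after
            (≤-trans (≤-reflexive (+-comm 2 (δ + (K + K)))) (+-monoʳ-≤ (δ + (K + K)) α≥2)) (n≤1+n M′))

      ones-M′≤δ+K : ones M′ ≤ δ + K
      ones-M′≤δ+K = ≮⇒≥ δ+K≮ones-δ+K≤ones-M′

      K<ones-M′ : 1 ≤ δ → K < ones M′
      K<ones-M′ δ≥1 = ≤-trans (+-monoˡ-≤ K (≤-trans (≤-reflexive (sym (prefix-hit true 0 starts-one)))
                                                    (prefix-mono true δ≥1)))
                              ones-δ+K≤ones-M′

      far-start : 1 ≤ δ → α + δ ≤ dp
      far-start δ≥1 = +-cancelʳ-≤ (K + K) (α + δ) dp
        (≤-trans (≤-reflexive (sym M′≡α+δ+2K)) (≤-trans M′≤dq zeros-span))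
        where
          last-but-one : Δ M′ ≡ false
          last-but-one = ¬-not λ hit → <⇒≱ (K<ones-M′ δ≥1) (ones-from-start hit ≤-refl 2K<M′)
          M′≤dq : M′ ≤ suc dq
          M′≤dq = ≮⇒≥ λ dq<M′ → prefix-const⇒colour false zeros-dq dq<M′ (n≤1+n M′) last-but-one

      ones-δ : ones δ ≡ δ
      ones-δ with δ ≟ 0
      ... | yes δ≡0 = subst (λ d → ones d ≡ d) (sym δ≡0) refl
      ... | no  δ≢0 = trans (sym (+-identityʳ (ones δ))) (trans (cong (ones δ +_) (sym no-zeros)) (ones+zeros δ))
        where
          no-zeros : zeros δ ≡ 0
          no-zeros = n≤0⇒n≡0 (subst (zeros δ ≤_) zeros-dp
                       (prefix-mono false (≤-trans (m≤n+m δ α) (far-start (n≢0⇒n>0 δ≢0)))))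

      ones-M′≡δ+K : ones M′ ≡ δ + K
      ones-M′≡δ+K = ≤-antisym ones-M′≤δ+K (subst (λ o → o + K ≤ ones M′) ones-δ ones-δ+K≤ones-M′)

      zeros-M≡K+α : zeros M ≡ K + α
      zeros-M≡K+α = trans zeros-M (+-cancelˡ-≡ (δ + K) (zeros M′) (K + α)
        (trans (cong (_+ zeros M′) (sym ones-M′≡δ+K)) (trans (ones+zeros M′) (rearrange δ α K))))
        where
          rearrange : ∀ δ α K → δ + (K + K) + α ≡ δ + K + (K + α)
          rearrange = solve-∀

      ones-2K : 1 ≤ δ → ones M′ ≡ ones (K + K)
      ones-2K δ≥1 = ≤-antisym (≮⇒≥ more) (prefix-mono true (≤-trans (n≤1+n (K + K)) 2K<M′))
        where
          more : ¬ (ones (K + K) < ones M′)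
          more 2K<ones with last-occurrence true M′ (≤-trans z<s 2K<ones)
          ... | de , de<M′ , de-one , ones-de = <⇒≱ (K<ones-M′ δ≥1)
                (subst (_≤ K) ones-de (ones-from-start de-one (s≤s de<M′) (s≤s 2K≤de)))
            where
              2K≤de : K + K ≤ de
              2K≤de = ≮⇒≥ λ de<2K → <⇒≱ 2K<ones (subst (_≤ ones (K + K)) ones-de (prefix-mono true de<2K))

      zeros-2K : 1 ≤ δ → zeros (K + K) ≡ α + β
      zeros-2K δ≥1 = +-cancelˡ-≡ (δ + K) (zeros (K + K)) (α + β)
        (trans (cong (_+ zeros (K + K)) (trans (sym ones-M′≡δ+K) (ones-2K δ≥1)))
               (trans (ones+zeros (K + K)) (rearrange β α δ)))
        where
          rearrange : ∀ β α δ → let K = β + α + δ in K + K ≡ δ + K + (α + β)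
          rearrange = solve-∀

      -- R will be 1^a H₀ 0 H₁ 1^(suc ν), the last block being [suc E, M].
      ν a E : ℕ
      ν = (α + δ) ∸ dp
      a = dp ⊓ (α + δ)
      E = M′ ∸ ν

      a+ν≡α+δ : a + ν ≡ α + δ
      a+ν≡α+δ = m⊓n+n∸m≡n dp (α + δ)

      ones-a : ones a ≡ a
      ones-a = trans (sym (+-identityʳ (ones a))) (trans (cong (ones a +_) (sym zeros-a)) (ones+zeros a))
        where
          zeros-a : zeros a ≡ 0
          zeros-a = n≤0⇒n≡0 (subst (zeros a ≤_) zeros-dp (prefix-mono false (m⊓n≤m dp (α + δ))))

      E+suc-ν≡M : E + suc ν ≡ M
      E+suc-ν≡M = trans (+-suc E ν) (cong suc (m∸n+n≡m (≤-trans (m∸n≤m (α + δ) dp)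
                    (≤-trans (m≤m+n (α + δ) (K + K)) (≤-reflexive (sym M′≡α+δ+2K))))))

      dq<E : suc dq ≤ E
      dq<E = m+n≤o⇒m≤o∸n (suc dq) dq+ν≤M′
        where
          dq+ν≤M′ : suc dq + ν ≤ M′
          dq+ν≤M′ with ≤-total dp (α + δ)
          ... | inj₁ dp≤α+δ = begin
            suc dq + ν             ≤⟨ +-monoˡ-≤ ν zeros-span ⟩
            dp + (K + K) + ν       ≡⟨ rearrange dp K ν ⟩
            (dp + ν) + (K + K)     ≡⟨ cong (_+ (K + K)) (m+[n∸m]≡n dp≤α+δ) ⟩
            α + δ + (K + K)        ≡⟨ M′≡α+δ+2K ⟨
            M′                     ∎
            where
              open ≤-Reasoning
              rearrange : ∀ d K n → d + (K + K) + n ≡ (d + n) + (K + K)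
              rearrange = solve-∀
          ... | inj₂ α+δ≤dp = subst (λ n → suc dq + n ≤ M′) (sym (m≤n⇒m∸n≡0 α+δ≤dp))
                                (≤-trans (≤-reflexive (+-identityʳ (suc dq))) (s≤s⁻¹ dq<M))

      zeros-E : zeros E ≡ zeros M
      zeros-E = ≤-antisym (prefix-mono false (≤-trans (m∸n≤m M′ ν) (n≤1+n M′)))
                          (≤-trans (≤-reflexive (sym zeros-dq)) (prefix-mono false dq<E))

      β<K : β < K
      β<K = subst (β <_) (sym (+-assoc β α δ)) (m<m+n β α+δ≥1)

      tail : count true (suc E) (suc ν) ≡ suc ν
      tail = prefix-const⇒count-not false E (suc ν) (trans zeros-E (cong zeros (sym E+suc-ν≡M)))

      -- suc dr is the (α + β + 1)-th zero, the one between H₀ and H₁.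
      module Pivot (dr : ℕ) (dr<M : dr < M) (dr-zero : Δ (suc dr) ≡ false) (zeros-dr : zeros dr ≡ α + β) where

        a≤dr : a ≤ dr
        a≤dr = prefix≡0⇒≤ false dr-zero
                 (n≤0⇒n≡0 (subst (zeros a ≤_) zeros-dp (prefix-mono false (m⊓n≤m dp (α + δ)))))

        dr<E : suc dr ≤ E
        dr<E = ≮⇒≥ λ E<dr → prefix-const⇒colour false zeros-E E<dr dr<M dr-zero

        l₀ l₁ μ : ℕ
        l₀ = dr ∸ a
        l₁ = E ∸ suc dr

        H₀ H₁ : List Bool
        H₀ = word Δ (segment (suc a) l₀)
        H₁ = word Δ (segment (suc (suc dr)) l₁)

        μ = occ true H₁

        zeros-suc-dr : zeros (suc dr) ≡ suc (α + β)
        zeros-suc-dr = trans (prefix-hit false dr dr-zero) (cong suc zeros-dr)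

        word-eq : word Δ (segment 1 M) ≡
          replicate (m ∸ 1 ∸ β ∸ ν) true ++ H₀ ++ false ∷ [] ++ H₁ ++ replicate (1 + ν) true
        word-eq = begin
          word Δ (segment 1 M)
            ≡⟨ cong (word Δ ∘ segment 1) M≡blocks ⟩
          word Δ (segment 1 (a + (l₀ + suc (l₁ + suc ν))))
            ≡⟨ word-blocks true l₀ l₁ true (m∸n+n≡m a≤dr) ones-a dr-zero
                 (subst (λ e → count true (suc e) (suc ν) ≡ suc ν) (sym (m+[n∸m]≡n dr<E)) tail) ⟩
          replicate a true ++ H₀ ++ false ∷ H₁ ++ replicate (suc ν) true
            ≡⟨ cong (λ i → replicate i true ++ H₀ ++ false ∷ H₁ ++ replicate (suc ν) true) a≡ ⟩
          replicate (m ∸ 1 ∸ β ∸ ν) true ++ H₀ ++ false ∷ H₁ ++ replicate (suc ν) true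
            ∎
          where
            open ≡-Reasoning
            M≡blocks : M ≡ a + (l₀ + suc (l₁ + suc ν))
            M≡blocks = begin
              M                                    ≡⟨ E+suc-ν≡M ⟨
              E + suc ν                            ≡⟨ cong (_+ suc ν) (m+[n∸m]≡n dr<E) ⟨
              suc dr + l₁ + suc ν                  ≡⟨ cong (λ r → suc r + l₁ + suc ν) (m+[n∸m]≡n a≤dr) ⟨
              suc (a + l₀) + l₁ + suc ν            ≡⟨ rearrange a l₀ l₁ ν ⟩
              a + (l₀ + suc (l₁ + suc ν))          ∎
              where
                rearrange : ∀ a l₀ l₁ ν → suc (a + l₀) + l₁ + suc ν ≡ a + (l₀ + suc (l₁ + suc ν))
                rearrange = solve-∀
            a≡ : a ≡ m ∸ 1 ∸ β ∸ ν
            a≡ = trans (sym (m+n∸n≡m a ν)) (cong (_∸ ν) (trans a+ν≡α+δ (sym K∸β≡α+δ)))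

        zeros-H₀ : occ false H₀ ≡ α + β
        zeros-H₀ = +-cancelˡ-≡ (zeros a) _ _ (trans (sym (prefix-split false a≤dr))
                     (trans zeros-dr (cong (_+ (α + β)) (sym zeros-a))))
          where
            zeros-a : zeros a ≡ 0
            zeros-a = n≤0⇒n≡0 (subst (zeros a ≤_) zeros-dp (prefix-mono false (m⊓n≤m dp (α + δ))))

        β≤K∸1 : β ≤ K ∸ 1
        β≤K∸1 = m+n≤o⇒m≤o∸n β (≤-trans (≤-reflexive (+-comm β 1)) β<K)

        zeros-H₁ : occ false H₁ ≡ m ∸ 2 ∸ β
        zeros-H₁ = +-cancelˡ-≡ (suc (α + β)) _ _ (begin
          suc (α + β) + occ false H₁         ≡⟨ cong (_+ occ false H₁) zeros-suc-dr ⟨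
          zeros (suc dr) + occ false H₁      ≡⟨ prefix-split false dr<E ⟨
          zeros E                            ≡⟨ trans zeros-E zeros-M≡K+α ⟩
          K + α                              ≡⟨ +-comm K α ⟩
          α + K                              ≡⟨ cong (α +_) (m+[n∸m]≡n K≥1) ⟨
          α + suc (K ∸ 1)                    ≡⟨ cong (λ k → α + suc k) (m∸n+n≡m β≤K∸1) ⟨
          α + suc (K ∸ 1 ∸ β + β)            ≡⟨ rearrange α β (K ∸ 1 ∸ β) ⟩
          suc (α + β) + (K ∸ 1 ∸ β)          ∎)
          where
            open ≡-Reasoning
            rearrange : ∀ α β t → α + suc (t + β) ≡ suc (α + β) + t
            rearrange = solve-∀

        length-H₁ : length H₁ ≡ m ∸ 2 ∸ β + μ
        length-H₁ = trans (sym (occ-true+occ-false H₁)) (trans (cong (μ +_) zeros-H₁) (+-comm μ _))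

        h₀ : ℕ
        h₀ = occ true H₀

        ones-M≡ : ones M ≡ a + h₀ + μ + suc ν
        ones-M≡ = begin
          ones M                                ≡⟨ cong ones E+suc-ν≡M ⟨
          ones (E + suc ν)                      ≡⟨ prefix-+ true E (suc ν) ⟩
          ones E + count true (suc E) (suc ν)   ≡⟨ cong₂ _+_ (prefix-split true dr<E) tail ⟩
          ones (suc dr) + μ + suc ν             ≡⟨ cong (λ o → o + μ + suc ν) ones-suc-dr ⟩
          ones a + h₀ + μ + suc ν               ≡⟨ cong (λ o → o + h₀ + μ + suc ν) ones-a ⟩
          a + h₀ + μ + suc ν                    ∎
          where
            open ≡-Reasoning
            ones-suc-dr : ones (suc dr) ≡ ones a + h₀
            ones-suc-dr = trans (prefix-miss true dr (not-¬ dr-zero)) (prefix-split true a≤dr)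

        h₀+μ≡β+δ : h₀ + μ ≡ β + δ
        h₀+μ≡β+δ = +-cancelˡ-≡ (α + δ) (h₀ + μ) (β + δ) (suc-injective (begin
          suc (α + δ + (h₀ + μ))             ≡⟨ cong (λ n → suc (n + (h₀ + μ))) a+ν≡α+δ ⟨
          suc (a + ν + (h₀ + μ))             ≡⟨ rearrange a ν h₀ μ ⟩
          a + h₀ + μ + suc ν                 ≡⟨ ones-M≡ ⟨
          ones M                             ≡⟨ trans ones-M (cong suc ones-M′≡δ+K) ⟩
          suc (δ + K)                        ≡⟨ cong suc (rearrange′ β α δ) ⟩
          suc (α + δ + (β + δ))              ∎))
          where
            open ≡-Reasoning
            rearrange : ∀ a ν h μ → suc (a + ν + (h + μ)) ≡ a + h + μ + suc ν
            rearrange = solve-∀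
            rearrange′ : ∀ β α δ → δ + (β + α + δ) ≡ α + δ + (β + δ)
            rearrange′ = solve-∀

        ones-H₀ : h₀ ≡ m ∸ 1 ∸ α ∸ μ
        ones-H₀ = trans (sym (m+n∸n≡m h₀ μ)) (cong (_∸ μ) (trans h₀+μ≡β+δ (sym K∸α≡β+δ)))

        length-H₀ : length H₀ ≡ m ∸ 1 + β ∸ μ
        length-H₀ = trans (sym (m+n∸n≡m (length H₀) μ)) (cong (_∸ μ) (begin
          length H₀ + μ                      ≡⟨ cong (_+ μ) (occ-true+occ-false H₀) ⟨
          h₀ + occ false H₀ + μ              ≡⟨ cong (λ z → h₀ + z + μ) zeros-H₀ ⟩
          h₀ + (α + β) + μ                   ≡⟨ rearrange h₀ μ α β ⟩
          h₀ + μ + (α + β)                   ≡⟨ cong (_+ (α + β)) h₀+μ≡β+δ ⟩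
          β + δ + (α + β)                    ≡⟨ rearrange′ β α δ ⟩
          K + β                              ∎))
          where
            open ≡-Reasoning
            rearrange : ∀ h μ α β → h + (α + β) + μ ≡ h + μ + (α + β)
            rearrange = solve-∀
            rearrange′ : ∀ β α δ → β + δ + (α + β) ≡ β + α + δ + β
            rearrange′ = solve-∀

        runs : β ≡ m ∸ 1 ∸ α ⊎ (ν ≡ 0 × μ ≡ 0)
        runs with δ ≟ 0
        ... | yes δ≡0 = inj₁ (sym (trans K∸α≡β+δ (trans (cong (β +_) δ≡0) (+-identityʳ β))))
        ... | no  δ≢0 = inj₂ (m≤n⇒m∸n≡0 (far-start δ≥1) , n≤0⇒n≡0 (+-cancelˡ-≤ (ones (suc dr)) μ 0 (begin
          ones (suc dr) + μ            ≡⟨ prefix-split true dr<E ⟨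
          ones E                       ≤⟨ prefix-mono true (m∸n≤m M′ ν) ⟩
          ones M′                      ≡⟨ ones-2K δ≥1 ⟩
          ones (K + K)                 ≤⟨ prefix-mono true (m≤n⇒m≤1+n 2K≤dr) ⟩
          ones (suc dr)                ≡⟨ +-identityʳ _ ⟨
          ones (suc dr) + 0            ∎)))
          where
            open ≤-Reasoning
            δ≥1 : 1 ≤ δ
            δ≥1 = n≢0⇒n>0 δ≢0
            2K≤dr : K + K ≤ dr
            2K≤dr = ≮⇒≥ λ dr<2K → <-irrefl refl (subst₂ _≤_ zeros-suc-dr (zeros-2K δ≥1) (prefix-mono false dr<2K))

        case-i : CaseI m Δ β α (segment 1 M)
        case-i = β≤K∸1 , many-zeros , μ , ν , H₀ , H₁ , word-eq , runs ,
                 length-H₁ , refl , zeros-H₁ , length-H₀ , ones-H₀ , zeros-H₀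

      case-i : CaseI m Δ β α (segment 1 M)
      case-i with occurrence false M (α + β) (subst (α + β <_) (sym zeros-M≡K+α)
                    (subst (_≤ K + α) (cong suc (+-comm β α)) (+-monoˡ-≤ α β<K)))
      ... | dr , dr<M , dr-zero , zeros-dr = Pivot.case-i dr dr<M dr-zero zeros-dr

    case-i : 1 ≤ α + δ → m ≤ zeros M → Δ 1 ≡ true → CaseI m Δ β α (segment 1 M)
    case-i α+δ≥1 many-zeros starts-one
      with occurrence false M 0 (≤-trans z<s many-zeros) | last-zero (≤-trans z<s many-zeros)
    ... | dp , _ , dp-zero , zeros-dp | dq , dq<M , dq-zero , zeros-dq =
      CaseI-setup.case-i α+δ≥1 many-zeros starts-one dp dp-zero zeros-dp dq dq<M dq-zero zeros-dq

    by-first-colour : ∀ b → Δ 1 ≡ b → 1 ≤ α + δ → m ≤ zeros M → Conclusion m Δ β α (segment 1 M)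
    by-first-colour true  one  α+δ≥1 many = inj₁ (case-i α+δ≥1 many one)
    by-first-colour false nil α+δ≥1 many = inj₂ (inj₁ (case-ii α+δ≥1 many nil))

    conclusion : Conclusion m Δ β α (segment 1 M)
    conclusion with α + δ ≟ 0 | zeros M <? m
    ... | yes α+δ≡0 | _        =
      inj₂ (inj₁ (case-ii-degenerate (m+n≡0⇒m≡0 α α+δ≡0) (m+n≡0⇒n≡0 α α+δ≡0)))
    ... | no  α+δ≢0 | yes few  = inj₂ (inj₂ (case-iii (n≢0⇒n>0 α+δ≢0) few))
    ... | no  α+δ≢0 | no  many = by-first-colour (Δ 1) refl (n≢0⇒n>0 α+δ≢0) (≮⇒≥ many)

analysis : ∀ Δ β α δ m M → let open Counting Δ; K = β + α + δ in
  m ≡ suc K → M ≡ suc (δ + (K + K) + α) → 1 ≤ K → Δ (suc δ) ≡ true → Δ M ≡ true →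
  prefix true δ + m ≤ prefix true M →
  (∀ c x y → Δ (suc x) ≡ c → Δ y ≡ c → y < M → suc (x + (2 * m ∸ 2)) ≤ y → prefix c y < prefix c x + m) →
  (∀ x → suc δ ≤ x → suc (x + (2 * m ∸ 2)) ≤ M → Δ (suc x) ≡ true → prefix true M < prefix true x + m) →
  Conclusion m Δ β α (interval 1 (3 * m ∸ 2 ∸ β))
analysis Δ β α δ _ _ refl refl K≥1 first-one last-one enough-ones window-bound start-bound =
  subst (Conclusion m Δ β α) (sym R≡segment)
    (conclusion K≥1 first-one last-one enough-ones
      (λ c x y x-hit y-hit y<M wide → window-bound c x y x-hit y-hit y<M (subst (λ w → suc (x + w) ≤ y) (sym 2m∸2≡2K) wide))
      (λ x δ<x x≤α+δ → start-bound x δ<x (subst (λ w → suc (x + w) ≤ M) (sym 2m∸2≡2K)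
                          (s≤s (≤-trans (+-monoˡ-≤ (K + K) x≤α+δ) (≤-reflexive (sym M′≡α+δ+2K)))))))
  where
    open Analysis Δ β α δ
    R≡segment : interval 1 (3 * m ∸ 2 ∸ β) ≡ segment 1 M
    R≡segment = trans (interval≡segment 1 _) (cong (segment 1) 3m∸2∸β≡M)
    2m∸2≡2K : 2 * m ∸ 2 ≡ K + K
    2m∸2≡2K = cong (_∸ 2) (split K)
      where
        split : ∀ K → 2 * suc K ≡ 2 + (K + K)
        split = solve-∀

lemma2p1 : (m : ℕ) → 2 ≤ m → (Δ : ℕ → Bool) → (B₁ : List ℕ) →
  Candidate Δ m B₁ →
  (∀ B → Candidate Δ m B → maxL B₁ ≤ maxL B) →
  (∀ B → Candidate Δ m B → maxL B ≡ maxL B₁ → diam B₁ ≤ diam B) →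
  All (λ x → Δ x ≡ true) B₁ →
  let β = (3 * m ∸ 2) ∸ maxL B₁
      α = diam B₁ ∸ (2 * m ∸ 2)
      R = interval 1 (3 * m ∸ 2 ∸ β)
      ΔR = word Δ R
      zerosR = occ false ΔR
  in
  -- (i)
  (β ≤ m ∸ 2 × m ≤ zerosR ×
    ∃ λ μ → ∃ λ ν → ∃ λ H₀ → ∃ λ H₁ →
      ΔR ≡ replicate (m ∸ 1 ∸ β ∸ ν) true ++ H₀ ++ false ∷ [] ++ H₁ ++ replicate (1 + ν) true
      × (β ≡ m ∸ 1 ∸ α ⊎ (ν ≡ 0 × μ ≡ 0))
      × length H₁ ≡ m ∸ 2 ∸ β + μ × occ true H₁ ≡ μ × occ false H₁ ≡ m ∸ 2 ∸ β
      × length H₀ ≡ m ∸ 1 + β ∸ μ × occ true H₀ ≡ m ∸ 1 ∸ α ∸ μ × occ false H₀ ≡ α + β)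
  ⊎
  -- (ii)
  ((β < m ∸ 1 ∸ α ⊎ β ≡ m ∸ 1) ×
    (∃ λ H₂ →
      ΔR ≡ replicate (m ∸ α ∸ β ∸ 1) false ++ true ∷ [] ++ H₂ ++ replicate (m ∸ β) true
      × length H₂ ≡ m ∸ 2 + β + α
      × (α > 0 → 1 ≤ β × occ true H₂ ≡ β ∸ 1))
    × (β ≤ m ∸ 2 → m ≤ zerosR))
  ⊎
  -- (iii)
  (α ≤ β × zerosR < m ×
    ∃ λ f₁ → ∃ λ fₘ →
      first Δ 1 true R ≡ just f₁ × first Δ m true R ≡ just fₘ
      × fₘ ≤ 3 * m ∸ 3 ∸ β ∸ α
      × occ false (word Δ (interval f₁ fₘ)) ≤ β)
lemma2p1 m 2≤m Δ [] ((_ , length≡m , _) , _) _ _ _ = ⊥-elim (<⇒≱ 2≤m (≤-trans (≤-reflexive (sym length≡m)) z≤n))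
lemma2p1 m 2≤m Δ B₁@(y ∷ B′) ((uniq , length≡m , inside) , _ , wide) max-minimal diam-minimal ones =
  analysis Δ β α δ m M (proj₁ shape) (proj₂ shape) (s≤s⁻¹ (subst (2 ≤_) (proj₁ shape) 2≤m)) first-one last-one
    (subst (λ n → prefix true δ + n ≤ prefix true M) length≡m
      (coloured-subset⇒prefix-gap true (≤-trans (n≤1+n δ) (subst (_≤ M) (sym b≡) b≤M)) uniq ones
        (All.tabulate λ p → subst (_≤ _) (sym b≡) (minL≤ B₁ p) , ≤maxL B₁ p)))
    (max-minimal⇒window-bound {B₁ = B₁} 2≤m M≤N max-minimal)
    (λ x δ<x → diam-minimal⇒start-bound {B₁ = B₁} 2≤m M≤N last-one diam-minimal x (subst (_≤ x) b≡ δ<x))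
  where
    open Counting Δ
    M b β α δ K : ℕ
    M = maxL B₁
    b = minL B₁
    β = 3 * m ∸ 2 ∸ M
    α = diam B₁ ∸ (2 * m ∸ 2)
    δ = b ∸ 1
    K = β + α + δ
    b≤M : b ≤ M
    b≤M = ≤maxL B₁ (minL-∈ y B′)
    M≤N : M ≤ 3 * m ∸ 2
    M≤N = proj₂ (All.lookup inside (maxL-∈ y B′))
    b≡ : suc δ ≡ b
    b≡ = m+[n∸m]≡n (proj₁ (All.lookup inside (minL-∈ y B′)))
    first-one : Δ (suc δ) ≡ true
    first-one = subst (λ x → Δ x ≡ true) (sym b≡) (All.lookup ones (minL-∈ y B′))
    last-one : Δ M ≡ true
    last-one = All.lookup ones (maxL-∈ y B′)
    shape : m ≡ suc K × M ≡ suc (δ + (K + K) + α)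
    shape = candidate-shape m (≤-trans (s≤s z≤n) 2≤m) (proj₁ (All.lookup inside (minL-∈ y B′))) b≤M M≤N wide
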